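{- Let $n,s,\ell,c$ be positive integers with $n=2s+c=3s-\ell$ and $c,\ell\in\{1,\dots,s-1\}$. Let $\mathcal{F}\subset 2^{[n]}$ be a shifted up-set containing no one-element sets, and let $d(\mathcal{F})=d\le 2c$. Then either $$|\overline{\mathcal{P}'(s,\ell)}|-\big(y_{\mathcal{F}}(0)+y_{\mathcal{F}}(1)+y_{\mathcal{F}}(2)\big)\le\frac{(4\ell+d-3)d}{2}$$ or $$|\overline{\mathcal{P}(s,\ell)}|-\big(y_{\mathcal{F}}(0)+y_{\mathcal{F}}(1)+y_{\mathcal{F}}(2)\big)\le\frac{(2\ell+6c-\lceil\frac d2\rceil+1)\lceil\frac d2\rceil}{2}.$$
   Context: $[m]=\{1,\dots,m\}$, $[a,b]=\{a,\dots,b\}$. For $\mathcal{G}\subset2^{[n]}$, $\overline{\mathcal{G}}=2^{[n]}\setminus\mathcal{G}$, $\mathcal{G}^{(i)}=\mathcal{G}\cap\binom{[n]}{i}$, $y_{\mathcal{G}}(i)=\binom ni-|\mathcal{G}^{(i)}|$. $\mathcal{P}(s,\ell)=\{P\subset[n]:|P|+|P\cap[\ell-1]|\ge3\}$, $\mathcal{P}'(s,\ell)=\binom{[n]}{\ge3}\cup\binom{[2\ell-1]}{2}$. An up-set is a family closed under taking supersets in $[n]$. Shifts: for $a<b$, $S_{a\leftarrow b}(A)=(A\setminus\{b\})\cup\{a\}$ if $b\in A,a\notin A$, else $A$; $S_{a\leftarrow b}(\mathcal{F})=\{S_{a\leftarrow b}(A):A\in\mathcal{F}\}\cup\{A\in\mathcal{F}:S_{a\leftarrow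 b}(A)\in\mathcal{F}\}$; $\mathcal{F}$ is shifted if $S_{a\leftarrow b}(\mathcal{F})=\mathcal{F}$ for all $a<b$. $d(\mathcal{F})$ is the smallest integer $d\ge 0$ such that either ($d$ even and for some $i\in[1,\ell+\frac d2]$, $\{i,2\ell+d+1-i\}\notin\mathcal{F}$) or ($d$ odd and either $\{1,2\ell+d\}\notin\mathcal{F}$, or for some $i\in[3,\ell+\frac{d+1}{2}]$, $\{i,2\ell+d+2-i\}\notin\mathcal{F}$). -}

module Defs where

open import Data.Bool using (Bool; true; false; _∧_; _∨_; not; if_then_else_)
open import Data.Nat using (ℕ; zero; suc; _+_; _*_; _∸_; _≤_; _<_; _≤ᵇ_; _<ᵇ_; ⌊_/2⌋; _%_)
open import Data.Nat.Combinatorics using (_C_)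
open import Data.Fin using (Fin; toℕ)
open import Data.Fin.Subset using (Subset; _⊆_; ∣_∣)
open import Data.Vec using (Vec; []; _∷_; lookup; tabulate; _[_]≔_)
open import Data.List using (List; []; _∷_; _++_; map; filter; length)
open import Data.Product using (Σ; _×_; ∃; ∃-syntax)
open import Data.Sum using (_⊎_)
open import Relation.Binary.PropositionalEquality using (_≡_)
open import Relation.Nullary using (¬_)
open import Function.Bundles using (_⇔_)

-- A family 𝓕 ⊂ 2^[n] is a Boolean-valued predicate on subsets of [n].
-- The ground set [n] = {1,…,n} is represented by Fin n, element k ↔ index k-1.
Family : ℕ → Set
Family n = Subset n → Bool

allSubsets : (n : ℕ) → List (Subset n)
allSubsets zero    = [] ∷ []
allSubsets (suc n) = map (false ∷_) (allSubsets n) ++ map (true ∷_) (allSubsets n)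

count : {n : ℕ} → (Subset n → Bool) → ℕ
count {n} p = length (filter (λ X → Data.Bool._≟_ (p X) true) (allSubsets n))
  where import Data.Bool

_==ℕ_ : ℕ → ℕ → Bool
a ==ℕ b = (a ≤ᵇ b) ∧ (b ≤ᵇ a)

layerCount : {n : ℕ} → Family n → ℕ → ℕ
layerCount G i = count (λ X → G X ∧ (∣ X ∣ ==ℕ i))

y : {n : ℕ} → Family n → ℕ → ℕ
y {n} G i = (n C i) ∸ layerCount G i

-- |P ∩ [m]|  (elements 1..m, i.e. indices with toℕ j < m)
capInitial : {n : ℕ} → ℕ → Subset n → ℕ
capInitial m X = ∣ tabulate (λ j → lookup X j ∧ (toℕ j <ᵇ m)) ∣

inP : {n : ℕ} → ℕ → Subset n → Bool
inP ℓ P = 3 ≤ᵇ (∣ P ∣ + capInitial (ℓ ∸ 1) P)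

inP' : {n : ℕ} → ℕ → Subset n → Bool
inP' ℓ P = (3 ≤ᵇ ∣ P ∣) ∨ ((∣ P ∣ ==ℕ 2) ∧ (capInitial (2 * ℓ ∸ 1) P ==ℕ 2))

complPCount : ℕ → ℕ → ℕ
complPCount n ℓ = count {n} (λ P → not (inP ℓ P))

complP'Count : ℕ → ℕ → ℕ
complP'Count n ℓ = count {n} (λ P → not (inP' ℓ P))

IsUpSet : {n : ℕ} → Family n → Set
IsUpSet {n} F = (A B : Subset n) → A ⊆ B → F A ≡ true → F B ≡ true

NoSingletons : {n : ℕ} → Family n → Set
NoSingletons {n} F = (X : Subset n) → ∣ X ∣ ≡ 1 → F X ≡ false

shiftSet : {n : ℕ} → Fin n → Fin n → Subset n → Subset n
shiftSet a b A =
  if lookup A b ∧ not (lookup A a) then ((A [ b ]≔ false) [ a ]≔ true) else A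

InShift : {n : ℕ} → Family n → Fin n → Fin n → Subset n → Set
InShift {n} F a b X =
  (∃[ A ] (F A ≡ true × shiftSet a b A ≡ X)) ⊎ (F X ≡ true × F (shiftSet a b X) ≡ true)

IsShifted : {n : ℕ} → Family n → Set
IsShifted {n} F = (a b : Fin n) → toℕ a < toℕ b → (X : Subset n) → (F X ≡ true) ⇔ InShift F a b X

-- is the pair {a,b} (a,b ∈ ℕ, 1-based) in 𝓕 ?  (false if not a subset of [n])
pairIn : {n : ℕ} → Family n → ℕ → ℕ → Bool
pairIn {n} F a b =
  (1 ≤ᵇ a) ∧ (a ≤ᵇ n) ∧ (1 ≤ᵇ b) ∧ (b ≤ᵇ n)
    ∧ F (tabulate (λ j → (suc (toℕ j) ==ℕ a) ∨ (suc (toℕ j) ==ℕ b)))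

DCond : {n : ℕ} → Family n → ℕ → ℕ → Set
DCond F ℓ d =
  (d % 2 ≡ 0 × ∃[ i ] (1 ≤ i × i ≤ ℓ + ⌊ d /2⌋ × pairIn F i (2 * ℓ + d + 1 ∸ i) ≡ false))
  ⊎ (d % 2 ≡ 1 ×
     (pairIn F 1 (2 * ℓ + d) ≡ false
      ⊎ ∃[ i ] (3 ≤ i × i ≤ ℓ + ⌊ (d + 1) /2⌋ × pairIn F i (2 * ℓ + d + 2 ∸ i) ≡ false)))

IsDOf : {n : ℕ} → Family n → ℕ → ℕ → Set
IsDOf F ℓ d = DCond F ℓ d × ((d' : ℕ) → d' < d → ¬ DCond F ℓ d')

-- Since F is an up-set without singletons, ∅ ∉ F, so y_F(0) + y_F(1) + y_F(2) = 1 + n + C(n,2) - m, where m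
-- is the number of pairs in F; the complements of 𝒫 and 𝒫' also consist of ∅, the singletons and some pairs,
-- so both alternatives are upper bounds on m. The defining condition of d = d(F) exhibits a pair {i, j} ∉ F
-- with i + j = 2ℓ + d + 1 or 2ℓ + d + 2 (or {1, 2ℓ + d}). As F is shifted, no pair {a, b} with a ≥ i, b ≥ j
-- is in F, whence m ≤ C(j-1,2) + (n-j+1)(i-1). When 2(n-j+1) ≤ j-1 this is at most C(2ℓ+d-1,2), the first
-- alternative; otherwise it is at most the number of pairs meeting [ℓ-1+⌈d/2⌉], the second one.

module Submission where

open import Data.Bool using (Bool; true; false; _∧_; _∨_; not; if_then_else_)
open import Data.Bool.Properties using (∧-zeroʳ; ∧-identityʳ; ∨-comm)
open import Data.Empty using (⊥; ⊥-elim)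
open import Data.Fin using (Fin; toℕ; fromℕ<) renaming (zero to fzero; suc to fsuc)
open import Data.Fin.Properties using (toℕ-injective; toℕ-fromℕ<)
open import Data.Fin.Subset using (Subset; ∣_∣)
open import Data.List using (List; []; _∷_; _++_; map; filter; length)
open import Data.Nat using (ℕ; zero; suc; pred; _+_; _*_; _∸_; _≤_; _<_; _≤ᵇ_; _<ᵇ_; z≤n; s≤s; _≤?_; ⌈_/2⌉; ⌊_/2⌋; _%_)
open import Data.Nat.Properties
open import Algebra.Properties.CommutativeSemigroup +-commutativeSemigroup using (interchange)
open import Data.Nat.Combinatorics using (_C_; nCk≡nC[n∸k]; nCn≡1; nC1≡n; nCk+nC[k+1]≡[n+1]C[k+1])
open import Data.Nat.Solver using (module +-*-Solver)
open import Data.Product using (_,_)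
open import Data.Sum using (_⊎_; inj₁; inj₂)
import Data.Sum as Sum
open import Data.Vec using ([]; _∷_; lookup; tabulate; _[_]≔_; there)
open import Data.Vec.Properties using (lookup∘tabulate; tabulate-cong; tabulate∘lookup; lookup∘update; lookup∘update′)
open import Function.Bundles using (Equivalence)
open import Relation.Binary.PropositionalEquality
open import Relation.Nullary using (¬_; Dec; yes; no)

open import Defs

open +-*-Solver

-- Counting subsets

𝟙 : Bool → ℕ
𝟙 true  = 1
𝟙 false = 0

𝟙≤1 : ∀ b → 𝟙 b ≤ 1
𝟙≤1 true  = s≤s z≤n
𝟙≤1 false = z≤n

countIn : {n : ℕ} → (Subset n → Bool) → List (Subset n) → ℕ
countIn p []       = 0
countIn p (X ∷ Xs) = 𝟙 (p X) + countIn p Xs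

number : (n : ℕ) → (Subset n → Bool) → ℕ
number n p = countIn p (allSubsets n)

length-filter≡countIn : {n : ℕ} (p : Subset n → Bool) (Xs : List (Subset n)) →
  length (filter (λ X → Data.Bool._≟_ (p X) true) Xs) ≡ countIn p Xs
length-filter≡countIn p [] = refl
length-filter≡countIn p (X ∷ Xs) with p X
... | true  = cong suc (length-filter≡countIn p Xs)
... | false = length-filter≡countIn p Xs

count≡number : {n : ℕ} (p : Subset n → Bool) → count p ≡ number n p
count≡number {n} p = length-filter≡countIn p (allSubsets n)

countIn-++ : {n : ℕ} (p : Subset n → Bool) (Xs Ys : List (Subset n)) →
  countIn p (Xs ++ Ys) ≡ countIn p Xs + countIn p Ys
countIn-++ p []       Ys = refl
countIn-++ p (X ∷ Xs) Ys = trans (cong (𝟙 (p X) +_) (countIn-++ p Xs Ys)) (sym (+-assoc (𝟙 (p X)) _ _))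

countIn-map : {m n : ℕ} (f : Subset m → Subset n) (p : Subset n → Bool) (Xs : List (Subset m)) →
  countIn p (map f Xs) ≡ countIn (λ X → p (f X)) Xs
countIn-map f p []       = refl
countIn-map f p (X ∷ Xs) = cong (𝟙 (p (f X)) +_) (countIn-map f p Xs)

countIn-cong : {n : ℕ} {p q : Subset n → Bool} → (∀ X → p X ≡ q X) → (Xs : List (Subset n)) →
  countIn p Xs ≡ countIn q Xs
countIn-cong p≗q []       = refl
countIn-cong p≗q (X ∷ Xs) = cong₂ _+_ (cong 𝟙 (p≗q X)) (countIn-cong p≗q Xs)

countIn-+ : {n : ℕ} {p q r : Subset n → Bool} → (∀ X → 𝟙 (p X) ≡ 𝟙 (q X) + 𝟙 (r X)) →
  (Xs : List (Subset n)) → countIn p Xs ≡ countIn q Xs + countIn r Xs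
countIn-+ split [] = refl
countIn-+ {q = q} {r} split (X ∷ Xs) rewrite split X | countIn-+ split Xs =
  interchange (𝟙 (q X)) (𝟙 (r X)) (countIn q Xs) (countIn r Xs)

countIn-false : {n : ℕ} (Xs : List (Subset n)) → countIn (λ _ → false) Xs ≡ 0
countIn-false []       = refl
countIn-false (X ∷ Xs) = countIn-false Xs

number-suc : (n : ℕ) (p : Subset (suc n) → Bool) →
  number (suc n) p ≡ number n (λ X → p (false ∷ X)) + number n (λ X → p (true ∷ X))
number-suc n p =
  trans (countIn-++ p (map (false ∷_) (allSubsets n)) (map (true ∷_) (allSubsets n)))
        (cong₂ _+_ (countIn-map (false ∷_) p (allSubsets n)) (countIn-map (true ∷_) p (allSubsets n)))

number-cong : (n : ℕ) {p q : Subset n → Bool} → (∀ X → p X ≡ q X) → number n p ≡ number n q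
number-cong n p≗q = countIn-cong p≗q (allSubsets n)

number-+ : (n : ℕ) {p q r : Subset n → Bool} → (∀ X → 𝟙 (p X) ≡ 𝟙 (q X) + 𝟙 (r X)) →
  number n p ≡ number n q + number n r
number-+ n split = countIn-+ split (allSubsets n)

number-empty : (n : ℕ) {p : Subset n → Bool} → (∀ X → p X ≡ false) → number n p ≡ 0
number-empty n p≗false = trans (number-cong n p≗false) (countIn-false (allSubsets n))

-- Sums over [1..n] and over pairs

sumTo : ℕ → (ℕ → ℕ) → ℕ
sumTo zero    f = 0
sumTo (suc n) f = f 1 + sumTo n (λ a → f (suc a))

-- sumPairs n q = Σ_{1 ≤ a < b ≤ n} q a b
sumPairs : ℕ → (ℕ → ℕ → ℕ) → ℕ
sumPairs zero    q = 0
sumPairs (suc n) q = sumTo n (λ b → q 1 (suc b)) + sumPairs n (λ a b → q (suc a) (suc b))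

C₂ : ℕ → ℕ
C₂ zero    = 0
C₂ (suc n) = n + C₂ n

sumTo-cong : ∀ n {f g : ℕ → ℕ} → (∀ a → a < n → f (suc a) ≡ g (suc a)) → sumTo n f ≡ sumTo n g
sumTo-cong zero    f≗g = refl
sumTo-cong (suc n) f≗g = cong₂ _+_ (f≗g 0 (s≤s z≤n)) (sumTo-cong n (λ a a<n → f≗g (suc a) (s≤s a<n)))

sumTo-mono-≤ : ∀ n {f g : ℕ → ℕ} → (∀ a → a < n → f (suc a) ≤ g (suc a)) → sumTo n f ≤ sumTo n g
sumTo-mono-≤ zero    f≤g = z≤n
sumTo-mono-≤ (suc n) f≤g = +-mono-≤ (f≤g 0 (s≤s z≤n)) (sumTo-mono-≤ n (λ a a<n → f≤g (suc a) (s≤s a<n)))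

sumTo-+ : ∀ n (f g : ℕ → ℕ) → sumTo n (λ a → f a + g a) ≡ sumTo n f + sumTo n g
sumTo-+ zero    f g = refl
sumTo-+ (suc n) f g = trans (cong (f 1 + g 1 +_) (sumTo-+ n _ _)) (interchange (f 1) (g 1) _ _)

sumTo-const : ∀ n k → sumTo n (λ _ → k) ≡ n * k
sumTo-const zero    k = refl
sumTo-const (suc n) k = cong (k +_) (sumTo-const n k)

sumTo-++ : ∀ m k (f : ℕ → ℕ) → sumTo (m + k) f ≡ sumTo m f + sumTo k (λ a → f (m + a))
sumTo-++ zero    k f = refl
sumTo-++ (suc m) k f = trans (cong (f 1 +_) (sumTo-++ m k (λ a → f (suc a)))) (sym (+-assoc (f 1) _ _))

sumTo-pred : ∀ n → sumTo n pred ≡ C₂ n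
sumTo-pred zero    = refl
sumTo-pred (suc n) = begin
  sumTo (suc n) pred             ≡⟨ cong (λ m → sumTo m pred) (+-comm 1 n) ⟩
  sumTo (n + 1) pred             ≡⟨ sumTo-++ n 1 pred ⟩
  sumTo n pred + (pred (n + 1) + 0) ≡⟨ cong₂ _+_ (sumTo-pred n) (trans (+-identityʳ _) (cong pred (+-comm n 1))) ⟩
  C₂ n + n                       ≡⟨ +-comm (C₂ n) n ⟩
  C₂ (suc n)                     ∎
  where open ≡-Reasoning

sumPairs-cong : ∀ n {f g : ℕ → ℕ → ℕ} → (∀ a b → a < b → b < n → f (suc a) (suc b) ≡ g (suc a) (suc b)) →
  sumPairs n f ≡ sumPairs n g
sumPairs-cong zero    f≗g = refl
sumPairs-cong (suc n) f≗g = cong₂ _+_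
  (sumTo-cong n (λ b b<n → f≗g 0 (suc b) (s≤s z≤n) (s≤s b<n)))
  (sumPairs-cong n (λ a b a<b b<n → f≗g (suc a) (suc b) (s≤s a<b) (s≤s b<n)))

sumPairs-mono-≤ : ∀ n {f g : ℕ → ℕ → ℕ} → (∀ a b → f a b ≤ g a b) → sumPairs n f ≤ sumPairs n g
sumPairs-mono-≤ zero    f≤g = z≤n
sumPairs-mono-≤ (suc n) f≤g =
  +-mono-≤ (sumTo-mono-≤ n (λ b _ → f≤g 1 (suc (suc b)))) (sumPairs-mono-≤ n (λ a b → f≤g (suc a) (suc b)))

sumPairs-columns : ∀ n (q : ℕ → ℕ → ℕ) → sumPairs n q ≡ sumTo n (λ b → sumTo (pred b) (λ a → q a b))
sumPairs-columns zero    q = refl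
sumPairs-columns (suc n) q =
  trans (cong (sumTo n (λ b → q 1 (suc b)) +_) (sumPairs-columns n (λ a b → q (suc a) (suc b))))
        (trans (sym (sumTo-+ n _ _)) (sumTo-cong n (λ b _ → refl)))

sumPairs-one : ∀ n → sumPairs n (λ _ _ → 1) ≡ C₂ n
sumPairs-one zero    = refl
sumPairs-one (suc n) = cong₂ _+_ (trans (sumTo-const n 1) (*-identityʳ n)) (sumPairs-one n)

C₂-+ : ∀ a b → C₂ (a + b) ≡ C₂ a + a * b + C₂ b
C₂-+ zero    b = refl
C₂-+ (suc a) b = trans (cong (a + b +_) (C₂-+ a b))
  (solve 5 (λ a b Ca ab Cb → (a :+ b) :+ (Ca :+ ab :+ Cb) := a :+ Ca :+ (b :+ ab) :+ Cb) refl a b (C₂ a) (a * b) (C₂ b))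

C₂-mono-≤ : ∀ {a b} → a ≤ b → C₂ a ≤ C₂ b
C₂-mono-≤ {a} {b} a≤b = begin
  C₂ a                         ≤⟨ m≤m+n (C₂ a) (a * (b ∸ a)) ⟩
  C₂ a + a * (b ∸ a)           ≤⟨ m≤m+n _ (C₂ (b ∸ a)) ⟩
  C₂ a + a * (b ∸ a) + C₂ (b ∸ a) ≡⟨ C₂-+ a (b ∸ a) ⟨
  C₂ (a + (b ∸ a))             ≡⟨ cong C₂ (m+[n∸m]≡n a≤b) ⟩
  C₂ b                         ∎
  where open ≤-Reasoning

2*C₂+n≡n*n : ∀ n → 2 * C₂ n + n ≡ n * n
2*C₂+n≡n*n zero    = refl
2*C₂+n≡n*n (suc n) = begin
  2 * (n + C₂ n) + suc n   ≡⟨ solve 2 (λ n t → con 2 :* (n :+ t) :+ (con 1 :+ n) := n :+ (con 2 :* t :+ n) :+ n :+ con 1) refl n (C₂ n) ⟩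
  n + (2 * C₂ n + n) + n + 1 ≡⟨ cong (λ z → n + z + n + 1) (2*C₂+n≡n*n n) ⟩
  n + n * n + n + 1        ≡⟨ solve 1 (λ n → n :+ n :* n :+ n :+ con 1 := (con 1 :+ n) :* (con 1 :+ n)) refl n ⟩
  suc n * suc n            ∎
  where open ≡-Reasoning

nC2≡C₂ : ∀ n → n C 2 ≡ C₂ n
nC2≡C₂ zero    = refl
nC2≡C₂ (suc n) = trans (sym (nCk+nC[k+1]≡[n+1]C[k+1] n 1)) (cong₂ _+_ (nC1≡n n) (nC2≡C₂ n))

-- Pairs and the layers of size at most two

==ℕ-suc : ∀ x y → (suc x ==ℕ suc y) ≡ (x ==ℕ y)
==ℕ-suc zero    zero    = refl
==ℕ-suc zero    (suc y) = refl
==ℕ-suc (suc x) zero    = refl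
==ℕ-suc (suc x) (suc y) = refl

==ℕ⇒≡ : ∀ x y → (x ==ℕ y) ≡ true → x ≡ y
==ℕ⇒≡ zero    zero    eq = refl
==ℕ⇒≡ (suc x) (suc y) eq = cong suc (==ℕ⇒≡ x y (trans (sym (==ℕ-suc x y)) eq))

==ℕ-refl : ∀ x → (x ==ℕ x) ≡ true
==ℕ-refl zero    = refl
==ℕ-refl (suc x) = trans (==ℕ-suc x x) (==ℕ-refl x)

≢⇒==ℕ-false : ∀ x y → ¬ x ≡ y → (x ==ℕ y) ≡ false
≢⇒==ℕ-false x y x≢y with x ==ℕ y in eq
... | true  = ⊥-elim (x≢y (==ℕ⇒≡ x y eq))
... | false = refl

suc-==ℕ-false : ∀ {c d} → c ≢ d → (suc c ==ℕ suc d) ≡ false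
suc-==ℕ-false c≢d = ≢⇒==ℕ-false _ _ (λ eq → c≢d (suc-injective eq))

<ᵇ-true : ∀ x y → x < y → (x <ᵇ y) ≡ true
<ᵇ-true zero    (suc y) x<y       = refl
<ᵇ-true (suc x) (suc y) (s≤s x<y) = <ᵇ-true x y x<y

<ᵇ-false : ∀ x y → y ≤ x → (x <ᵇ y) ≡ false
<ᵇ-false x       zero    y≤x       = refl
<ᵇ-false (suc x) (suc y) (s≤s y≤x) = <ᵇ-false x y y≤x

-- Elements are 1-based, so an argument 0 contributes nothing: pair 0 a = {a} and pair 0 0 = ∅.
pair : {n : ℕ} → ℕ → ℕ → Subset n
pair a b = tabulate (λ j → (suc (toℕ j) ==ℕ a) ∨ (suc (toℕ j) ==ℕ b))

lookup-pair : ∀ {n} a b (j : Fin n) → lookup (pair {n} a b) j ≡ (suc (toℕ j) ==ℕ a) ∨ (suc (toℕ j) ==ℕ b)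
lookup-pair a b = lookup∘tabulate (λ j → (suc (toℕ j) ==ℕ a) ∨ (suc (toℕ j) ==ℕ b))

pair-comm : ∀ {n} a b → pair {n} a b ≡ pair b a
pair-comm a b = tabulate-cong (λ j → ∨-comm (suc (toℕ j) ==ℕ a) (suc (toℕ j) ==ℕ b))

pair-∋ : ∀ {n} (z : Fin n) b → lookup (pair (suc (toℕ z)) b) z ≡ true
pair-∋ z b = trans (lookup-pair (suc (toℕ z)) b z) (cong (_∨ (suc (toℕ z) ==ℕ b)) (==ℕ-refl (suc (toℕ z))))

lookup-pair-other : ∀ {n} (z : Fin n) a b → toℕ z ≢ a → lookup (pair (suc a) b) z ≡ (suc (toℕ z) ==ℕ b)
lookup-pair-other z a b z≢a = trans (lookup-pair (suc a) b z) (cong (_∨ (suc (toℕ z) ==ℕ b)) (suc-==ℕ-false z≢a))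

pair-∌ : ∀ {n} (z : Fin n) a b → toℕ z ≢ a → toℕ z ≢ b → lookup (pair (suc a) (suc b)) z ≡ false
pair-∌ z a b z≢a z≢b = trans (lookup-pair-other z a (suc b) z≢a) (suc-==ℕ-false z≢b)

pairIn≡F-pair : ∀ {n} (F : Family n) a b → a < n → b < n → pairIn F (suc a) (suc b) ≡ F (pair (suc a) (suc b))
pairIn≡F-pair {n} F a b a<n b<n rewrite <ᵇ-true a n a<n | <ᵇ-true b n b<n = refl

∣tabulate∣≡sumTo : ∀ n (g : ℕ → Bool) → ∣ tabulate {n = n} (λ j → g (suc (toℕ j))) ∣ ≡ sumTo n (λ x → 𝟙 (g x))
∣tabulate∣≡sumTo zero    g = refl
∣tabulate∣≡sumTo (suc n) g with g 1
... | true  = cong suc (∣tabulate∣≡sumTo n (λ x → g (suc x)))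
... | false = ∣tabulate∣≡sumTo n (λ x → g (suc x))

sumTo-indicator : ∀ n a (h : ℕ → Bool) → a < n → sumTo n (λ x → 𝟙 ((x ==ℕ suc a) ∧ h x)) ≡ 𝟙 (h (suc a))
sumTo-indicator (suc n) zero    h a<n = trans (cong (𝟙 (h 1) +_) (trans (sumTo-cong n absent) (sumTo-const n 0)))
                                               (trans (cong (𝟙 (h 1) +_) (*-zeroʳ n)) (+-identityʳ _))
  where
  absent : ∀ x → x < n → 𝟙 ((suc (suc x) ==ℕ 1) ∧ h (suc (suc x))) ≡ 0
  absent x _ = refl
sumTo-indicator (suc n) (suc a) h (s≤s a<n) =
  trans (sumTo-cong n (λ x _ → cong (λ e → 𝟙 (e ∧ h (suc (suc x)))) (==ℕ-suc (suc x) (suc a))))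
        (sumTo-indicator n a (λ x → h (suc x)) a<n)

capInitial-pair : ∀ {n} m a b → a < n → b < n → ¬ a ≡ b →
  capInitial {n} m (pair (suc a) (suc b)) ≡ 𝟙 (a <ᵇ m) + 𝟙 (b <ᵇ m)
capInitial-pair {n} m a b a<n b<n a≢b = begin
  capInitial {n} m (pair (suc a) (suc b))
    ≡⟨ cong (∣_∣ {n}) (tabulate-cong (λ j → cong (_∧ (toℕ j <ᵇ m)) (lookup-pair (suc a) (suc b) j))) ⟩
  ∣ tabulate {n = n} (λ j → inPair (suc (toℕ j)) ∧ (suc (toℕ j) ≤ᵇ m)) ∣
    ≡⟨ ∣tabulate∣≡sumTo n (λ x → inPair x ∧ (x ≤ᵇ m)) ⟩
  sumTo n (λ x → 𝟙 (inPair x ∧ (x ≤ᵇ m)))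
    ≡⟨ trans (sumTo-cong n (λ x _ → split (suc x))) (sumTo-+ n _ _) ⟩
  sumTo n (λ x → 𝟙 ((x ==ℕ suc a) ∧ (x ≤ᵇ m))) + sumTo n (λ x → 𝟙 ((x ==ℕ suc b) ∧ (x ≤ᵇ m)))
    ≡⟨ cong₂ _+_ (sumTo-indicator n a (_≤ᵇ m) a<n) (sumTo-indicator n b (_≤ᵇ m) b<n) ⟩
  𝟙 (a <ᵇ m) + 𝟙 (b <ᵇ m) ∎
  where
  open ≡-Reasoning
  inPair : ℕ → Bool
  inPair x = (x ==ℕ suc a) ∨ (x ==ℕ suc b)
  split : ∀ x → 𝟙 (inPair x ∧ (x ≤ᵇ m)) ≡ 𝟙 ((x ==ℕ suc a) ∧ (x ≤ᵇ m)) + 𝟙 ((x ==ℕ suc b) ∧ (x ≤ᵇ m))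
  split x with x ==ℕ suc a in ea | x ==ℕ suc b in eb
  ... | true  | true  = ⊥-elim (a≢b (suc-injective (trans (sym (==ℕ⇒≡ x _ ea)) (==ℕ⇒≡ x _ eb))))
  ... | true  | false = sym (+-identityʳ _)
  ... | false | true  = refl
  ... | false | false = refl

capInitial≤∣∣ : ∀ {n} m (X : Subset n) → capInitial m X ≤ ∣ X ∣
capInitial≤∣∣ m X = go X (λ j → toℕ j <ᵇ m)
  where
  go : ∀ {k} (X : Subset k) (g : Fin k → Bool) → ∣ tabulate (λ j → lookup X j ∧ g j) ∣ ≤ ∣ X ∣
  go []          g = z≤n
  go (true ∷ X)  g with g fzero
  ... | true  = s≤s (go X (λ j → g (fsuc j)))
  ... | false = m≤n⇒m≤1+n (go X (λ j → g (fsuc j)))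
  go (false ∷ X) g = go X (λ j → g (fsuc j))

number-size0 : ∀ n (r : Subset n → Bool) → number n (λ X → r X ∧ (∣ X ∣ ==ℕ 0)) ≡ 𝟙 (r (pair 0 0))
number-size0 zero    r = trans (+-identityʳ _) (cong 𝟙 (∧-identityʳ (r [])))
number-size0 (suc n) r = begin
  number (suc n) (λ X → r X ∧ (∣ X ∣ ==ℕ 0))
    ≡⟨ number-suc n _ ⟩
  number n (λ X → r (false ∷ X) ∧ (∣ X ∣ ==ℕ 0)) + number n (λ X → r (true ∷ X) ∧ false)
    ≡⟨ cong₂ _+_ (number-size0 n (λ X → r (false ∷ X))) (number-empty n (λ X → ∧-zeroʳ (r (true ∷ X)))) ⟩
  𝟙 (r (pair 0 0)) + 0
    ≡⟨ +-identityʳ _ ⟩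
  𝟙 (r (pair 0 0)) ∎
  where open ≡-Reasoning

number-size1 : ∀ n (r : Subset n → Bool) → number n (λ X → r X ∧ (∣ X ∣ ==ℕ 1)) ≡ sumTo n (λ a → 𝟙 (r (pair 0 a)))
number-size1 zero    r = trans (+-identityʳ _) (cong 𝟙 (∧-zeroʳ (r [])))
number-size1 (suc n) r = begin
  number (suc n) (λ X → r X ∧ (∣ X ∣ ==ℕ 1))
    ≡⟨ trans (number-suc n _) (+-comm (number n (λ X → r (false ∷ X) ∧ (∣ X ∣ ==ℕ 1))) _) ⟩
  number n (λ X → r (true ∷ X) ∧ (suc ∣ X ∣ ==ℕ 1)) + number n (λ X → r (false ∷ X) ∧ (∣ X ∣ ==ℕ 1))
    ≡⟨ cong₂ _+_ (trans (number-cong n (λ X → cong (r (true ∷ X) ∧_) (==ℕ-suc ∣ X ∣ 0)))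
                        (number-size0 n (λ X → r (true ∷ X))))
                 (trans (number-size1 n (λ X → r (false ∷ X))) (sumTo-cong n (λ a _ → refl))) ⟩
  sumTo (suc n) (λ a → 𝟙 (r (pair 0 a))) ∎
  where open ≡-Reasoning

number-size2 : ∀ n (r : Subset n → Bool) → number n (λ X → r X ∧ (∣ X ∣ ==ℕ 2)) ≡ sumPairs n (λ a b → 𝟙 (r (pair a b)))
number-size2 zero    r = trans (+-identityʳ _) (cong 𝟙 (∧-zeroʳ (r [])))
number-size2 (suc n) r = begin
  number (suc n) (λ X → r X ∧ (∣ X ∣ ==ℕ 2))
    ≡⟨ trans (number-suc n _) (+-comm (number n (λ X → r (false ∷ X) ∧ (∣ X ∣ ==ℕ 2))) _) ⟩
  number n (λ X → r (true ∷ X) ∧ (suc ∣ X ∣ ==ℕ 2)) + number n (λ X → r (false ∷ X) ∧ (∣ X ∣ ==ℕ 2))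
    ≡⟨ cong₂ _+_ (trans (number-cong n (λ X → cong (r (true ∷ X) ∧_) (==ℕ-suc ∣ X ∣ 1)))
                        (trans (number-size1 n (λ X → r (true ∷ X))) (sumTo-cong n (λ a _ → refl))))
                 (trans (number-size2 n (λ X → r (false ∷ X))) (sumPairs-cong n (λ a b _ _ → refl))) ⟩
  sumPairs (suc n) (λ a b → 𝟙 (r (pair a b))) ∎
  where open ≡-Reasoning

number-size≤1 : ∀ n → number n (λ X → ∣ X ∣ ≤ᵇ 1) ≡ 1 + n
number-size≤1 n = begin
  number n (λ X → ∣ X ∣ ≤ᵇ 1)
    ≡⟨ number-+ n (λ X → split ∣ X ∣) ⟩
  number n (λ X → ∣ X ∣ ==ℕ 0) + number n (λ X → ∣ X ∣ ==ℕ 1)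
    ≡⟨ cong₂ _+_ (number-size0 n (λ _ → true)) (number-size1 n (λ _ → true)) ⟩
  1 + sumTo n (λ _ → 1)
    ≡⟨ cong suc (trans (sumTo-const n 1) (*-identityʳ n)) ⟩
  1 + n ∎
  where
  open ≡-Reasoning
  split : ∀ s → 𝟙 (s ≤ᵇ 1) ≡ 𝟙 (s ==ℕ 0) + 𝟙 (s ==ℕ 1)
  split zero          = refl
  split (suc zero)    = refl
  split (suc (suc s)) = refl

pairsIn : {n : ℕ} → Family n → ℕ
pairsIn {n} F = sumPairs n (λ a b → 𝟙 (F (pair a b)))

pairsIn≤C₂ : ∀ {n} (F : Family n) → pairsIn F ≤ C₂ n
pairsIn≤C₂ {n} F = ≤-trans (sumPairs-mono-≤ n (λ a b → 𝟙≤1 (F (pair a b)))) (≤-reflexive (sumPairs-one n))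

∅∉upSet : ∀ {n} (F : Family (suc n)) → IsUpSet F → NoSingletons F → ∀ X → ∣ X ∣ ≡ 0 → F X ≡ false
∅∉upSet F upSet noSingletons (false ∷ X) ∣X∣≡0 with F (false ∷ X) in X∈F
... | false = refl
... | true with () ← trans (sym (noSingletons (true ∷ X) (cong suc ∣X∣≡0))) (upSet _ _ (λ { (there x∈X) → there x∈X }) X∈F)

y-sum : ∀ {n} (F : Family n) → 1 ≤ n → IsUpSet F → NoSingletons F →
  y F 0 + y F 1 + y F 2 ≡ 1 + n + (C₂ n ∸ pairsIn F)
y-sum {suc n} F _ upSet noSingletons = cong₂ _+_ (cong₂ _+_ y0 y1) y2
  where
  noLayer : ∀ k → (∀ X → ∣ X ∣ ≡ k → F X ≡ false) → layerCount F k ≡ 0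
  noLayer k F∌ = trans (count≡number {suc n} _) (number-empty (suc n) absent)
    where
    absent : ∀ X → F X ∧ (∣ X ∣ ==ℕ k) ≡ false
    absent X with ∣ X ∣ ==ℕ k in eq
    ... | true  = cong (_∧ true) (F∌ X (==ℕ⇒≡ _ k eq))
    ... | false = ∧-zeroʳ (F X)
  y0 : y F 0 ≡ 1
  y0 = cong₂ _∸_ (trans (nCk≡nC[n∸k] {0} {suc n} z≤n) (nCn≡1 (suc n))) (noLayer 0 (∅∉upSet F upSet noSingletons))
  y1 : y F 1 ≡ suc n
  y1 = cong₂ _∸_ (nC1≡n (suc n)) (noLayer 1 noSingletons)
  y2 : y F 2 ≡ C₂ (suc n) ∸ pairsIn F
  y2 = cong₂ _∸_ (nC2≡C₂ (suc n)) (trans (count≡number {suc n} _) (number-size2 (suc n) F))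

-- The complements of 𝒫 and 𝒫'

sumPairs-above : ∀ l w → sumPairs (l + w) (λ a b → 𝟙 (l <ᵇ a)) ≡ C₂ w
sumPairs-above zero    w = trans (sumPairs-cong w (λ a b _ _ → refl)) (sumPairs-one w)
sumPairs-above (suc l) w = cong₂ _+_ (trans (sumTo-const (l + w) 0) (*-zeroʳ (l + w))) (sumPairs-above l w)

sumPairs-beyond : ∀ {M n} → M ≤ n → sumPairs n (λ a b → 𝟙 (M <ᵇ b)) + C₂ M ≡ C₂ n
sumPairs-beyond {M} {n} M≤n = begin
  sumPairs n (λ a b → 𝟙 (M <ᵇ b)) + C₂ M
    ≡⟨ cong (_+ C₂ M) (trans (sumPairs-columns n _) (sumTo-cong n (λ b _ → sumTo-const b _))) ⟩
  sumTo n column + C₂ M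
    ≡⟨ cong (λ k → sumTo k column + C₂ M) (sym n≡M+r) ⟩
  sumTo (M + r) column + C₂ M
    ≡⟨ cong (_+ C₂ M) (sumTo-++ M r column) ⟩
  sumTo M column + sumTo r (λ x → column (M + x)) + C₂ M
    ≡⟨ cong₂ (λ u v → u + v + C₂ M) (trans (sumTo-cong M inside) (trans (sumTo-const M 0) (*-zeroʳ M)))
                                      (sumTo-cong r outside) ⟩
  sumTo r (λ x → pred (M + x)) + C₂ M
    ≡⟨ +-comm _ (C₂ M) ⟩
  C₂ M + sumTo r (λ x → pred (M + x))
    ≡⟨ cong (_+ sumTo r (λ x → pred (M + x))) (sym (sumTo-pred M)) ⟩
  sumTo M pred + sumTo r (λ x → pred (M + x))
    ≡⟨ sym (sumTo-++ M r pred) ⟩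
  sumTo (M + r) pred
    ≡⟨ trans (sumTo-pred (M + r)) (cong C₂ n≡M+r) ⟩
  C₂ n ∎
  where
  open ≡-Reasoning
  column : ℕ → ℕ
  column b = pred b * 𝟙 (M <ᵇ b)
  r = n ∸ M
  n≡M+r : M + r ≡ n
  n≡M+r = m+[n∸m]≡n M≤n
  inside : ∀ x → x < M → column (suc x) ≡ 0
  inside x x<M = trans (cong (λ b → x * 𝟙 b) (<ᵇ-false M (suc x) x<M)) (*-zeroʳ x)
  outside : ∀ x → x < r → column (M + suc x) ≡ pred (M + suc x)
  outside x _ = trans (cong (λ b → pred (M + suc x) * 𝟙 b) (<ᵇ-true M (M + suc x) (m<m+n M (s≤s z≤n))))
                      (*-identityʳ _)

notInP'-split : ∀ s (b : Bool) → 𝟙 (not ((3 ≤ᵇ s) ∨ ((s ==ℕ 2) ∧ b))) ≡ 𝟙 (s ≤ᵇ 1) + 𝟙 (not b ∧ (s ==ℕ 2))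
notInP'-split zero                true  = refl
notInP'-split zero                false = refl
notInP'-split (suc zero)          true  = refl
notInP'-split (suc zero)          false = refl
notInP'-split (suc (suc zero))    true  = refl
notInP'-split (suc (suc zero))    false = refl
notInP'-split (suc (suc (suc s))) true  = refl
notInP'-split (suc (suc (suc s))) false = refl

notInP-split : ∀ s k → k ≤ s → 𝟙 (not (3 ≤ᵇ (s + k))) ≡ 𝟙 (s ≤ᵇ 1) + 𝟙 (not (1 ≤ᵇ k) ∧ (s ==ℕ 2))
notInP-split zero                zero    _              = refl
notInP-split (suc zero)          zero    _              = refl
notInP-split (suc zero)          (suc zero) _           = refl
notInP-split (suc zero)          (suc (suc k)) (s≤s ())
notInP-split (suc (suc zero))    zero    _              = refl
notInP-split (suc (suc zero))    (suc k) _              = refl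
notInP-split (suc (suc (suc s))) zero    _              = refl
notInP-split (suc (suc (suc s))) (suc k) _              = refl

complP'Count≡ : ∀ n ℓ → 2 * ℓ ∸ 1 ≤ n → complP'Count n ℓ + C₂ (2 * ℓ ∸ 1) ≡ 1 + n + C₂ n
complP'Count≡ n ℓ M≤n = begin
  complP'Count n ℓ + C₂ M
    ≡⟨ cong (_+ C₂ M) (trans (count≡number {n} _) (number-+ n (λ X → notInP'-split ∣ X ∣ (capInitial M X ==ℕ 2)))) ⟩
  number n (λ X → ∣ X ∣ ≤ᵇ 1) + number n (λ X → not (capInitial M X ==ℕ 2) ∧ (∣ X ∣ ==ℕ 2)) + C₂ M
    ≡⟨ cong₂ (λ u v → u + v + C₂ M) (number-size≤1 n)
             (trans (number-size2 n (λ X → not (capInitial M X ==ℕ 2))) (sumPairs-cong n beyond)) ⟩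
  1 + n + sumPairs n (λ a b → 𝟙 (M <ᵇ b)) + C₂ M
    ≡⟨ trans (+-assoc (1 + n) _ _) (cong (1 + n +_) (sumPairs-beyond M≤n)) ⟩
  1 + n + C₂ n ∎
  where
  open ≡-Reasoning
  M = 2 * ℓ ∸ 1
  beyond : ∀ a b → a < b → b < n → 𝟙 (not (capInitial M (pair {n} (suc a) (suc b)) ==ℕ 2)) ≡ 𝟙 (M <ᵇ suc b)
  beyond a b a<b b<n rewrite capInitial-pair {n} M a b (<-trans a<b b<n) b<n (<⇒≢ a<b) with M ≤? b
  ... | yes M≤b rewrite <ᵇ-false b M M≤b | <ᵇ-true M (suc b) (s≤s M≤b) with a <ᵇ M
  ...   | true  = refl
  ...   | false = refl
  beyond a b a<b b<n | no M≰b
    rewrite <ᵇ-true b M (≰⇒> M≰b) | <ᵇ-true a M (<-trans a<b (≰⇒> M≰b)) | <ᵇ-false M (suc b) (≰⇒> M≰b) = refl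

complPCount≡ : ∀ n ℓ → ℓ ∸ 1 ≤ n → complPCount n ℓ ≡ 1 + n + C₂ (n ∸ (ℓ ∸ 1))
complPCount≡ n ℓ L≤n = begin
  complPCount n ℓ
    ≡⟨ trans (count≡number {n} _) (number-+ n (λ X → notInP-split ∣ X ∣ (capInitial L X) (capInitial≤∣∣ L X))) ⟩
  number n (λ X → ∣ X ∣ ≤ᵇ 1) + number n (λ X → not (1 ≤ᵇ capInitial L X) ∧ (∣ X ∣ ==ℕ 2))
    ≡⟨ cong₂ _+_ (number-size≤1 n)
             (trans (number-size2 n (λ X → not (1 ≤ᵇ capInitial L X))) (sumPairs-cong n above)) ⟩
  1 + n + sumPairs n (λ a b → 𝟙 (L <ᵇ a))
    ≡⟨ cong (1 + n +_) (subst (λ k → sumPairs k (λ a b → 𝟙 (L <ᵇ a)) ≡ C₂ (k ∸ L)) (m+[n∸m]≡n L≤n)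
                          (trans (sumPairs-above L (n ∸ L)) (cong C₂ (sym (m+n∸m≡n L (n ∸ L)))))) ⟩
  1 + n + C₂ (n ∸ L) ∎
  where
  open ≡-Reasoning
  L = ℓ ∸ 1
  above : ∀ a b → a < b → b < n → 𝟙 (not (1 ≤ᵇ capInitial L (pair {n} (suc a) (suc b)))) ≡ 𝟙 (L <ᵇ suc a)
  above a b a<b b<n rewrite capInitial-pair {n} L a b (<-trans a<b b<n) b<n (<⇒≢ a<b) with L ≤? a
  ... | yes L≤a rewrite <ᵇ-false a L L≤a | <ᵇ-false b L (≤-trans L≤a (<⇒≤ a<b)) | <ᵇ-true L (suc a) (s≤s L≤a) = refl
  ... | no L≰a rewrite <ᵇ-true a L (≰⇒> L≰a) | <ᵇ-false L (suc a) (≰⇒> L≰a) = refl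

-- Shifted families

shiftSet-moves : ∀ {n} (x y : Fin n) A → lookup A y ≡ true → lookup A x ≡ false →
  shiftSet x y A ≡ (A [ y ]≔ false) [ x ]≔ true
shiftSet-moves x y A y∈A x∉A =
  cong (λ b → if b then (A [ y ]≔ false) [ x ]≔ true else A) (cong₂ _∧_ y∈A (cong not x∉A))

shiftSet-fixes : ∀ {n} (x y : Fin n) A → (lookup A y ∧ not (lookup A x)) ≡ false → shiftSet x y A ≡ A
shiftSet-fixes x y A stays = cong (λ b → if b then (A [ y ]≔ false) [ x ]≔ true else A) stays

-- X is not a shift S(A) of any A: a moved A gives x ∈ S(A), and an unmoved A = X would itself move.
shifted-closed : ∀ {n} (F : Family n) → IsShifted F → (x y : Fin n) → toℕ x < toℕ y → (X : Subset n) →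
  lookup X y ≡ true → lookup X x ≡ false → F X ≡ true → F (shiftSet x y X) ≡ true
shifted-closed F shifted x y x<y X y∈X x∉X X∈F with Equivalence.to (shifted x y x<y X) X∈F
... | inj₂ (_ , shiftX∈F) = shiftX∈F
... | inj₁ (A , _ , shiftA≡X) = ⊥-elim (impossible (lookup A y) (lookup A x) refl refl)
  where
  open ≡-Reasoning
  impossible : ∀ u v → lookup A y ≡ u → lookup A x ≡ v → ⊥
  impossible true false y∈A x∉A with () ← begin
    true                                         ≡⟨ lookup∘update x (A [ y ]≔ false) true ⟨
    lookup ((A [ y ]≔ false) [ x ]≔ true) x      ≡⟨ cong (λ Z → lookup Z x) (shiftSet-moves x y A y∈A x∉A) ⟨
    lookup (shiftSet x y A) x                    ≡⟨ cong (λ Z → lookup Z x) shiftA≡X ⟩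
    lookup X x                                   ≡⟨ x∉X ⟩
    false                                        ∎
  impossible true true y∈A x∈A with () ← begin
    true         ≡⟨ x∈A ⟨
    lookup A x   ≡⟨ cong (λ Z → lookup Z x) (trans (sym (shiftSet-fixes x y A (cong₂ _∧_ y∈A (cong not x∈A)))) shiftA≡X) ⟩
    lookup X x   ≡⟨ x∉X ⟩
    false        ∎
  impossible false _ y∉A _ with () ← begin
    false        ≡⟨ y∉A ⟨
    lookup A y   ≡⟨ cong (λ Z → lookup Z y) (trans (sym (shiftSet-fixes x y A (cong (_∧ _) y∉A))) shiftA≡X) ⟩
    lookup X y   ≡⟨ y∈X ⟩
    true         ∎

shiftSet-pair : ∀ {n} (x y : Fin n) o → x ≢ y → o ≢ toℕ x → o ≢ toℕ y →
  shiftSet x y (pair (suc (toℕ y)) (suc o)) ≡ pair (suc (toℕ x)) (suc o)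
shiftSet-pair x y o x≢y o≢x o≢y =
  trans (shiftSet-moves x y V (pair-∋ y (suc o)) (pair-∌ x (toℕ y) o (toℕ≢ x≢y) (≢-sym o≢x)))
        (trans (sym (tabulate∘lookup _)) (trans (tabulate-cong pointwise) (tabulate∘lookup _)))
  where
  V = pair (suc (toℕ y)) (suc o)
  toℕ≢ : ∀ {z w} → z ≢ w → toℕ z ≢ toℕ w
  toℕ≢ z≢w eq = z≢w (toℕ-injective eq)
  pointwise : ∀ z → lookup ((V [ y ]≔ false) [ x ]≔ true) z ≡ lookup (pair (suc (toℕ x)) (suc o)) z
  pointwise z with z Data.Fin.≟ x | z Data.Fin.≟ y
  ... | yes refl | _ = trans (lookup∘update z (V [ y ]≔ false) true) (sym (pair-∋ z (suc o)))
  ... | no z≢x | yes refl =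
    trans (lookup∘update′ z≢x (V [ z ]≔ false) true) (trans (lookup∘update z V false)
      (sym (pair-∌ z (toℕ x) o (toℕ≢ z≢x) (≢-sym o≢y))))
  ... | no z≢x | no z≢y =
    trans (lookup∘update′ z≢x (V [ y ]≔ false) true) (trans (lookup∘update′ z≢y V false)
      (trans (lookup-pair-other z (toℕ y) (suc o) (toℕ≢ z≢y)) (sym (lookup-pair-other z (toℕ x) (suc o) (toℕ≢ z≢x)))))

shifted-pair-down : ∀ {n} (F : Family n) → IsShifted F → ∀ {c e} o → c < e → e < n → o ≢ c → o ≢ e →
  F (pair (suc e) (suc o)) ≡ true → F (pair (suc c) (suc o)) ≡ true
shifted-pair-down F shifted {c} {e} o c<e e<n o≢c o≢e eo∈F
  with fromℕ< (<-trans c<e e<n) | toℕ-fromℕ< (<-trans c<e e<n) | fromℕ< e<n | toℕ-fromℕ< e<n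
... | x | refl | y | refl =
  subst (λ Z → F Z ≡ true) (shiftSet-pair x y o (λ x≡y → <-irrefl (cong toℕ x≡y) c<e) o≢c o≢e)
    (shifted-closed F shifted x y c<e _ (pair-∋ y (suc o)) (pair-∌ x (toℕ y) o (<⇒≢ c<e) (≢-sym o≢c)) eo∈F)

shifted-pair-≤ˡ : ∀ {n} (F : Family n) → IsShifted F → ∀ {i a b} → i ≤ a → a < b → b < n →
  F (pair (suc a) (suc b)) ≡ true → F (pair (suc i) (suc b)) ≡ true
shifted-pair-≤ˡ F shifted i≤a a<b b<n ab∈F with m≤n⇒m<n∨m≡n i≤a
... | inj₂ refl = ab∈F
... | inj₁ i<a = shifted-pair-down F shifted _ i<a (<-trans a<b b<n) (>⇒≢ (<-trans i<a a<b)) (>⇒≢ a<b) ab∈F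

shifted-pair-≤ʳ : ∀ {n} (F : Family n) → IsShifted F → ∀ {i j b} → i < j → j ≤ b → b < n →
  F (pair (suc i) (suc b)) ≡ true → F (pair (suc i) (suc j)) ≡ true
shifted-pair-≤ʳ F shifted {i} {j} {b} i<j j≤b b<n ib∈F with m≤n⇒m<n∨m≡n j≤b
... | inj₂ refl = ib∈F
... | inj₁ j<b = subst (λ Z → F Z ≡ true) (pair-comm (suc j) (suc i))
  (shifted-pair-down F shifted i j<b b<n (<⇒≢ i<j) (<⇒≢ (<-trans i<j j<b))
    (subst (λ Z → F Z ≡ true) (pair-comm (suc i) (suc b)) ib∈F))

shifted-pair-≤ : ∀ {n} (F : Family n) → IsShifted F → ∀ {i j a b} → i ≤ a → j ≤ b → i < j → a < b → b < n →
  F (pair (suc a) (suc b)) ≡ true → F (pair (suc i) (suc j)) ≡ true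
shifted-pair-≤ F shifted i≤a j≤b i<j a<b b<n ab∈F =
  shifted-pair-≤ʳ F shifted i<j j≤b b<n (shifted-pair-≤ˡ F shifted i≤a a<b b<n ab∈F)

sumTo-≤ᵇ : ∀ i k → sumTo (i + k) (λ a → 𝟙 (a ≤ᵇ i)) ≡ i
sumTo-≤ᵇ i k = begin
  sumTo (i + k) (λ a → 𝟙 (a ≤ᵇ i))
    ≡⟨ sumTo-++ i k _ ⟩
  sumTo i (λ a → 𝟙 (a ≤ᵇ i)) + sumTo k (λ x → 𝟙 (i + x ≤ᵇ i))
    ≡⟨ cong₂ _+_ (sumTo-cong i (λ a a<i → cong 𝟙 (<ᵇ-true a i a<i))) (sumTo-cong k (λ x _ → beyond x)) ⟩
  sumTo i (λ _ → 1) + sumTo k (λ _ → 0)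
    ≡⟨ cong₂ _+_ (trans (sumTo-const i 1) (*-identityʳ i)) (trans (sumTo-const k 0) (*-zeroʳ k)) ⟩
  i + 0
    ≡⟨ +-identityʳ i ⟩
  i ∎
  where
  open ≡-Reasoning
  beyond : ∀ x → 𝟙 (i + suc x ≤ᵇ i) ≡ 0
  beyond x rewrite +-suc i x = cong 𝟙 (<ᵇ-false (i + x) i (m≤m+n i x))

-- By shiftedness no pair {a+1, b+1} with a ≥ i, b ≥ j lies in F, so the column of F at b+1 holds
-- at most b pairs, and at most i once b ≥ j.
pairsIn-bound : ∀ {n} (F : Family n) → IsShifted F → ∀ {i j} → i < j → pairIn F (suc i) (suc j) ≡ false →
  pairsIn F ≤ C₂ j + (n ∸ j) * i
pairsIn-bound {n} F shifted {i} {j} i<j ij∉F with j ≤? n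
... | no j≰n = ≤-trans (pairsIn≤C₂ F) (≤-trans (C₂-mono-≤ (<⇒≤ (≰⇒> j≰n))) (m≤m+n (C₂ j) _))
... | yes j≤n = begin
  pairsIn F
    ≡⟨ sumPairs-columns n _ ⟩
  sumTo n column
    ≡⟨ cong (λ k → sumTo k column) (sym (m+[n∸m]≡n j≤n)) ⟩
  sumTo (j + u) column
    ≡⟨ sumTo-++ j u column ⟩
  sumTo j column + sumTo u (λ x → column (j + x))
    ≤⟨ +-mono-≤ (sumTo-mono-≤ j (λ b _ → early b)) (sumTo-mono-≤ u late) ⟩
  sumTo j pred + sumTo u (λ _ → i)
    ≡⟨ cong₂ _+_ (sumTo-pred j) (sumTo-const u i) ⟩
  C₂ j + u * i ∎
  where
  open ≤-Reasoning
  u = n ∸ j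
  column : ℕ → ℕ
  column b = sumTo (pred b) (λ a → 𝟙 (F (pair a b)))
  early : ∀ b → column (suc b) ≤ b
  early b = ≤-trans (sumTo-mono-≤ b (λ a _ → 𝟙≤1 _)) (≤-reflexive (trans (sumTo-const b 1) (*-identityʳ b)))
  late : ∀ x → x < u → column (j + suc x) ≤ i
  late x x<u rewrite +-suc j x = begin
    sumTo (j + x) (λ a → 𝟙 (F (pair a (suc (j + x)))))
      ≤⟨ sumTo-mono-≤ (j + x) entry ⟩
    sumTo (j + x) (λ a → 𝟙 (a ≤ᵇ i))
      ≡⟨ cong (λ k → sumTo k (λ a → 𝟙 (a ≤ᵇ i))) (sym (m+[n∸m]≡n i≤j+x)) ⟩
    sumTo (i + (j + x ∸ i)) (λ a → 𝟙 (a ≤ᵇ i))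
      ≡⟨ sumTo-≤ᵇ i (j + x ∸ i) ⟩
    i ∎
    where
    i≤j+x = ≤-trans (<⇒≤ i<j) (m≤m+n j x)
    j+x<n : j + x < n
    j+x<n = subst (j + x <_) (m+[n∸m]≡n j≤n) (+-monoʳ-< j x<u)
    entry : ∀ a → a < j + x → 𝟙 (F (pair (suc a) (suc (j + x)))) ≤ 𝟙 (suc a ≤ᵇ i)
    entry a a<j+x with i ≤? a
    ... | no i≰a rewrite <ᵇ-true a i (≰⇒> i≰a) = 𝟙≤1 _
    ... | yes i≤a with F (pair (suc a) (suc (j + x))) in ab∈F
    ...   | false = z≤n
    ...   | true with () ← trans (sym ij∉F)
                (trans (pairIn≡F-pair F i j (<-trans i<j (≤-<-trans (m≤m+n j x) j+x<n)) (≤-<-trans (m≤m+n j x) j+x<n))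
                       (shifted-pair-≤ F shifted i≤a (m≤m+n j x) i<j a<j+x j+x<n ab∈F))

-- The two bounds

2*[a*b+C₂b]+b≡[2a+b]*b : ∀ a b → 2 * (a * b + C₂ b) + b ≡ (2 * a + b) * b
2*[a*b+C₂b]+b≡[2a+b]*b a b = begin
  2 * (a * b + C₂ b) + b ≡⟨ solve 3 (λ a b t → con 2 :* (a :* b :+ t) :+ b := con 2 :* a :* b :+ (con 2 :* t :+ b)) refl a b (C₂ b) ⟩
  2 * a * b + (2 * C₂ b + b) ≡⟨ cong (2 * a * b +_) (2*C₂+n≡n*n b) ⟩
  2 * a * b + b * b      ≡⟨ solve 2 (λ a b → con 2 :* a :* b :+ b :* b := (con 2 :* a :+ b) :* b) refl a b ⟩
  (2 * a + b) * b        ∎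
  where open ≡-Reasoning

complement-bound : ∀ x c b {a N m} → x + a ≡ c + N + b → m ≤ N → m ≤ a → x ≤ c + (N ∸ m) + b
complement-bound x c b {a} {N} {m} x+a≡ m≤N m≤a = +-cancelʳ-≤ m x (c + (N ∸ m) + b) (begin
  x + m                   ≤⟨ +-monoʳ-≤ x m≤a ⟩
  x + a                   ≡⟨ x+a≡ ⟩
  c + N + b               ≡⟨ cong (λ z → c + z + b) (sym (m+[n∸m]≡n m≤N)) ⟩
  c + (m + (N ∸ m)) + b   ≡⟨ solve 4 (λ c m r b → c :+ (m :+ r) :+ b := c :+ r :+ b :+ m) refl c m (N ∸ m) b ⟩
  c + (N ∸ m) + b + m     ∎)
  where open ≤-Reasoning

C₂-short-tail : ∀ A u p k → 2 * u ≤ A → p ≤ 2 * k → C₂ A + u * p ≤ C₂ (A + k)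
C₂-short-tail A u p k 2u≤A p≤2k = begin
  C₂ A + u * p           ≤⟨ +-monoʳ-≤ (C₂ A) (*-monoʳ-≤ u p≤2k) ⟩
  C₂ A + u * (2 * k)     ≡⟨ cong (C₂ A +_) (solve 2 (λ u k → u :* (con 2 :* k) := con 2 :* u :* k) refl u k) ⟩
  C₂ A + 2 * u * k       ≤⟨ +-monoʳ-≤ (C₂ A) (*-monoˡ-≤ k 2u≤A) ⟩
  C₂ A + A * k           ≤⟨ m≤m+n _ (C₂ k) ⟩
  C₂ A + A * k + C₂ k    ≡⟨ C₂-+ A k ⟨
  C₂ (A + k)             ∎
  where open ≤-Reasoning

C₂-long-tail : ∀ p q u → 2 + p + 2 * q ≤ 2 * u → C₂ (1 + p + 2 * q) + u * p ≤ C₂ (p + q) + (p + q) * (1 + q + u)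
C₂-long-tail p q u 2+p+2q≤2u = begin
  C₂ (1 + p + 2 * q) + u * p
    ≡⟨ cong (λ z → C₂ z + u * p) (solve 2 (λ p q → con 1 :+ p :+ con 2 :* q := (p :+ q) :+ (con 1 :+ q)) refl p q) ⟩
  C₂ ((p + q) + (1 + q)) + u * p
    ≡⟨ cong (_+ u * p) (C₂-+ (p + q) (1 + q)) ⟩
  C₂ (p + q) + (p + q) * (1 + q) + C₂ (1 + q) + u * p
    ≤⟨ +-monoˡ-≤ (u * p) (+-monoʳ-≤ (C₂ (p + q) + (p + q) * (1 + q)) C₂[1+q]≤q*u) ⟩
  C₂ (p + q) + (p + q) * (1 + q) + q * u + u * p
    ≡⟨ solve 4 (λ p q u t → t :+ (p :+ q) :* (con 1 :+ q) :+ q :* u :+ u :* p := t :+ (p :+ q) :* (con 1 :+ q :+ u))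
               refl p q u (C₂ (p + q)) ⟩
  C₂ (p + q) + (p + q) * (1 + q + u) ∎
  where
  open ≤-Reasoning
  1+q≤2u : 1 + q ≤ 2 * u
  1+q≤2u = ≤-trans (subst (1 + q ≤_) (solve 2 (λ p q → (con 1 :+ q) :+ (con 1 :+ p :+ q) := con 2 :+ p :+ con 2 :* q) refl p q)
                              (m≤m+n (1 + q) (1 + p + q)))
                   2+p+2q≤2u
  C₂[1+q]≤q*u : C₂ (1 + q) ≤ q * u
  C₂[1+q]≤q*u = *-cancelˡ-≤ 2 (+-cancelʳ-≤ (1 + q) (2 * C₂ (1 + q)) (2 * (q * u)) (begin
    2 * C₂ (1 + q) + (1 + q) ≡⟨ 2*C₂+n≡n*n (1 + q) ⟩
    (1 + q) * (1 + q)       ≡⟨ solve 1 (λ q → (con 1 :+ q) :* (con 1 :+ q) := q :* (con 1 :+ q) :+ (con 1 :+ q)) refl q ⟩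
    q * (1 + q) + (1 + q)   ≤⟨ +-monoˡ-≤ (1 + q) (*-monoʳ-≤ q 1+q≤2u) ⟩
    q * (2 * u) + (1 + q)   ≡⟨ cong (_+ (1 + q)) (solve 2 (λ q u → q :* (con 2 :* u) := con 2 :* (q :* u)) refl q u) ⟩
    2 * (q * u) + (1 + q)   ∎))

-- For the missing pair {p+1, j+1} with p + j = 2L + 1, pairsIn-bound gives C₂ j + (n-j) p; this is at most
-- C₂ (j + k) when 2(n-j) ≤ j, and otherwise at most C₂ L + L (n-L), the number of pairs meeting [L].
missingPair-dichotomy : ∀ {n} (F : Family n) → IsShifted F → ∀ {L p k} → p ≤ L → p ≤ 2 * k →
  pairIn F (suc p) (3 + 2 * L ∸ suc p) ≡ false →
  pairsIn F ≤ C₂ (1 + 2 * L ∸ p + k) ⊎ pairsIn F ≤ C₂ L + L * (n ∸ L)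
missingPair-dichotomy {n} F shifted {L} {p} {k} p≤L p≤2k ij∉F with L ∸ p | m+[n∸m]≡n p≤L
... | q | refl = decide (2 * u ≤? j)
  where
  j = 1 + p + 2 * q
  u = n ∸ j
  j≡ : 1 + 2 * (p + q) ∸ p ≡ j
  j≡ = trans (cong (_∸ p) (solve 2 (λ p q → con 1 :+ con 2 :* (p :+ q) := p :+ (con 1 :+ p :+ con 2 :* q)) refl p q))
             (m+n∸m≡n p j)
  suc-j≡ : 3 + 2 * (p + q) ∸ suc p ≡ suc j
  suc-j≡ = trans (cong (_∸ suc p) (solve 2 (λ p q → con 3 :+ con 2 :* (p :+ q) := (con 1 :+ p) :+ (con 2 :+ p :+ con 2 :* q)) refl p q))
                 (m+n∸m≡n (suc p) (suc j))
  bound : pairsIn F ≤ C₂ j + u * p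
  bound = pairsIn-bound F shifted (s≤s (m≤m+n p (2 * q))) (trans (cong (pairIn F (suc p)) (sym suc-j≡)) ij∉F)
  j≤n : ¬ 2 * u ≤ j → j ≤ n
  j≤n 2u≰j with j ≤? n
  ... | yes j≤n = j≤n
  ... | no j≰n = ⊥-elim (2u≰j (subst (λ v → 2 * v ≤ j) (sym (m≤n⇒m∸n≡0 (<⇒≤ (≰⇒> j≰n)))) z≤n))
  decide : Dec (2 * u ≤ j) → pairsIn F ≤ C₂ (1 + 2 * (p + q) ∸ p + k) ⊎ pairsIn F ≤ C₂ (p + q) + (p + q) * (n ∸ (p + q))
  decide (yes 2u≤j) = inj₁ (≤-trans bound
    (subst (λ z → C₂ j + u * p ≤ C₂ (z + k)) (sym j≡) (C₂-short-tail j u p k 2u≤j p≤2k)))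
  decide (no 2u≰j) = inj₂ (≤-trans bound
    (subst (λ z → C₂ j + u * p ≤ C₂ (p + q) + (p + q) * z) (sym n∸L≡) (C₂-long-tail p q u (≰⇒> 2u≰j))))
    where
    n∸L≡ : n ∸ (p + q) ≡ 1 + q + u
    n∸L≡ = trans (cong (_∸ (p + q)) (trans (sym (m+[n∸m]≡n (j≤n 2u≰j)))
                   (solve 3 (λ p q u → (con 1 :+ p :+ con 2 :* q) :+ u := (p :+ q) :+ (con 1 :+ q :+ u)) refl p q u)))
                 (m+n∸m≡n (p + q) (1 + q + u))

option₁ : ∀ {n} (F : Family n) l d → 1 + 2 * l ≤ n → 1 ≤ n → IsUpSet F → NoSingletons F →
  pairsIn F ≤ C₂ (1 + 2 * l + d) →
  2 * complP'Count n (suc l) ≤ 2 * (y F 0 + y F 1 + y F 2) + (4 * suc l + d ∸ 3) * d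
option₁ {n} F l d M≤n 1≤n upSet noSingletons bound = begin
  2 * complP'Count n (suc l)
    ≤⟨ *-monoʳ-≤ 2 (complement-bound (complP'Count n (suc l)) (1 + n) W complP'+C₂[M+d] (pairsIn≤C₂ F) bound) ⟩
  2 * (1 + n + (C₂ n ∸ pairsIn F) + W)
    ≡⟨ solve 2 (λ Y W → con 2 :* (Y :+ W) := con 2 :* Y :+ con 2 :* W) refl (1 + n + (C₂ n ∸ pairsIn F)) W ⟩
  2 * (1 + n + (C₂ n ∸ pairsIn F)) + 2 * W
    ≡⟨ cong₂ (λ Y z → 2 * Y + z) (sym (y-sum F 1≤n upSet noSingletons)) (sym 2W≡) ⟩
  2 * (y F 0 + y F 1 + y F 2) + (4 * suc l + d ∸ 3) * d ∎
  where
  open ≤-Reasoning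
  M = 1 + 2 * l
  W = M * d + C₂ d
  2*ℓ∸1≡M : 2 * suc l ∸ 1 ≡ M
  2*ℓ∸1≡M = cong (_∸ 1) (solve 1 (λ l → con 2 :* (con 1 :+ l) := con 1 :+ (con 1 :+ con 2 :* l)) refl l)
  complP'+C₂[M+d] : complP'Count n (suc l) + C₂ (M + d) ≡ 1 + n + C₂ n + W
  complP'+C₂[M+d] = begin-equality
    complP'Count n (suc l) + C₂ (M + d)       ≡⟨ cong (complP'Count n (suc l) +_) (trans (C₂-+ M d) (+-assoc (C₂ M) _ _)) ⟩
    complP'Count n (suc l) + (C₂ M + W)       ≡⟨ +-assoc (complP'Count n (suc l)) (C₂ M) W ⟨
    complP'Count n (suc l) + C₂ M + W         ≡⟨ cong (λ z → complP'Count n (suc l) + C₂ z + W) 2*ℓ∸1≡M ⟨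
    complP'Count n (suc l) + C₂ (2 * suc l ∸ 1) + W
      ≡⟨ cong (_+ W) (complP'Count≡ n (suc l) (subst (_≤ n) (sym 2*ℓ∸1≡M) M≤n)) ⟩
    1 + n + C₂ n + W ∎
  2W≡ : (4 * suc l + d ∸ 3) * d ≡ 2 * W
  2W≡ = +-cancelʳ-≡ d _ _ (begin-equality
    (4 * suc l + d ∸ 3) * d + d
      ≡⟨ cong (λ z → (z ∸ 3) * d + d) (solve 2 (λ l d → con 4 :* (con 1 :+ l) :+ d := con 3 :+ (con 1 :+ con 4 :* l :+ d)) refl l d) ⟩
    (3 + (1 + 4 * l + d) ∸ 3) * d + d
      ≡⟨ cong (λ z → z * d + d) (m+n∸m≡n 3 (1 + 4 * l + d)) ⟩
    (1 + 4 * l + d) * d + d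
      ≡⟨ solve 2 (λ l d → (con 1 :+ con 4 :* l :+ d) :* d :+ d := (con 2 :* (con 1 :+ con 2 :* l) :+ d) :* d) refl l d ⟩
    (2 * M + d) * d
      ≡⟨ 2*[a*b+C₂b]+b≡[2a+b]*b M d ⟨
    2 * W + d ∎)

option₂ : ∀ {n} (F : Family n) l c h → n ≡ 2 * suc l + 3 * c → h ≤ c → 1 ≤ n → IsUpSet F → NoSingletons F →
  pairsIn F ≤ C₂ (l + h) + (l + h) * (n ∸ (l + h)) →
  2 * complPCount n (suc l) ≤ 2 * (y F 0 + y F 1 + y F 2) + (2 * suc l + 6 * c + 1 ∸ h) * h
option₂ {n} F l c h n≡ h≤c 1≤n upSet noSingletons bound = begin
  2 * complPCount n (suc l)
    ≤⟨ *-monoʳ-≤ 2 (complement-bound (complPCount n (suc l)) (1 + n) W complP+outside (pairsIn≤C₂ F) bound) ⟩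
  2 * (1 + n + (C₂ n ∸ pairsIn F) + W)
    ≡⟨ solve 2 (λ Y W → con 2 :* (Y :+ W) := con 2 :* Y :+ con 2 :* W) refl (1 + n + (C₂ n ∸ pairsIn F)) W ⟩
  2 * (1 + n + (C₂ n ∸ pairsIn F)) + 2 * W
    ≡⟨ cong₂ (λ Y z → 2 * Y + z) (sym (y-sum F 1≤n upSet noSingletons)) (sym 2W≡) ⟩
  2 * (y F 0 + y F 1 + y F 2) + (2 * suc l + 6 * c + 1 ∸ h) * h ∎
  where
  open ≤-Reasoning
  L = l + h
  v = n ∸ L
  e = c ∸ h
  W = v * h + C₂ h
  c≡ : c ≡ h + e
  c≡ = sym (m+[n∸m]≡n h≤c)
  n≡' : n ≡ (l + h) + (2 + l + 2 * h + 3 * e)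
  n≡' = trans n≡ (trans (cong (λ z → 2 * suc l + 3 * z) c≡)
          (solve 3 (λ l h e → con 2 :* (con 1 :+ l) :+ con 3 :* (h :+ e) := (l :+ h) :+ (con 2 :+ l :+ con 2 :* h :+ con 3 :* e)) refl l h e))
  v≡ : v ≡ 2 + l + 2 * h + 3 * e
  v≡ = trans (cong (_∸ L) n≡') (m+n∸m≡n L _)
  L+v≡n : L + v ≡ n
  L+v≡n = trans (cong (L +_) v≡) (sym n≡')
  n∸l≡ : n ∸ l ≡ v + h
  n∸l≡ = trans (cong (_∸ l) (trans (sym L+v≡n) (solve 3 (λ l h v → (l :+ h) :+ v := l :+ (v :+ h)) refl l h v)))
               (m+n∸m≡n l (v + h))
  complP+outside : complPCount n (suc l) + (C₂ L + L * v) ≡ 1 + n + C₂ n + W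
  complP+outside = begin-equality
    complPCount n (suc l) + (C₂ L + L * v)
      ≡⟨ cong (_+ (C₂ L + L * v)) (complPCount≡ n (suc l) (subst (l ≤_) L+v≡n (≤-trans (m≤m+n l h) (m≤m+n L v)))) ⟩
    1 + n + C₂ (n ∸ l) + (C₂ L + L * v)
      ≡⟨ cong (λ z → 1 + n + C₂ z + (C₂ L + L * v)) n∸l≡ ⟩
    1 + n + C₂ (v + h) + (C₂ L + L * v)
      ≡⟨ cong (λ z → 1 + n + z + (C₂ L + L * v)) (C₂-+ v h) ⟩
    1 + n + (C₂ v + v * h + C₂ h) + (C₂ L + L * v)
      ≡⟨ solve 7 (λ N Cv vh Ch CL Lv dummy → N :+ (Cv :+ vh :+ Ch) :+ (CL :+ Lv) := N :+ (CL :+ Lv :+ Cv) :+ (vh :+ Ch))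
               refl (1 + n) (C₂ v) (v * h) (C₂ h) (C₂ L) (L * v) 0 ⟩
    1 + n + (C₂ L + L * v + C₂ v) + W
      ≡⟨ cong (λ z → 1 + n + z + W) (trans (sym (C₂-+ L v)) (cong C₂ L+v≡n)) ⟩
    1 + n + C₂ n + W ∎
  2W≡ : (2 * suc l + 6 * c + 1 ∸ h) * h ≡ 2 * W
  2W≡ = +-cancelʳ-≡ h _ _ (begin-equality
    (2 * suc l + 6 * c + 1 ∸ h) * h + h
      ≡⟨ cong (λ z → (z ∸ h) * h + h) (trans (cong (λ z → 2 * suc l + 6 * z + 1) c≡)
           (solve 3 (λ l h e → con 2 :* (con 1 :+ l) :+ con 6 :* (h :+ e) :+ con 1
                             := h :+ (con 3 :+ con 2 :* l :+ con 5 :* h :+ con 6 :* e)) refl l h e)) ⟩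
    (h + (3 + 2 * l + 5 * h + 6 * e) ∸ h) * h + h
      ≡⟨ cong (λ z → z * h + h) (m+n∸m≡n h _) ⟩
    (3 + 2 * l + 5 * h + 6 * e) * h + h
      ≡⟨ solve 3 (λ l h e → (con 3 :+ con 2 :* l :+ con 5 :* h :+ con 6 :* e) :* h :+ h
                           := (con 2 :* (con 2 :+ l :+ con 2 :* h :+ con 3 :* e) :+ h) :* h) refl l h e ⟩
    (2 * (2 + l + 2 * h + 3 * e) + h) * h
      ≡⟨ cong (λ z → (2 * z + h) * h) v≡ ⟨
    (2 * v + h) * h
      ≡⟨ 2*[a*b+C₂b]+b≡[2a+b]*b v h ⟨
    2 * W + h ∎)

-- The condition defining d(F)

data Parity : ℕ → Set where
  even : ∀ q → Parity (q + q)
  odd  : ∀ q → Parity (suc (q + q))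

parity : ∀ d → Parity d
parity zero = even 0
parity (suc d) with parity d
... | even q = odd q
... | odd q  = subst Parity (cong suc (+-suc q q)) (even (suc q))

even%2≡0 : ∀ q → (q + q) % 2 ≡ 0
even%2≡0 zero    = refl
even%2≡0 (suc q) rewrite +-suc q q = even%2≡0 q

odd%2≡1 : ∀ q → suc (q + q) % 2 ≡ 1
odd%2≡1 zero    = refl
odd%2≡1 (suc q) rewrite +-suc q q = odd%2≡1 q

PairsInBounds : ∀ {n} → Family n → ℕ → ℕ → Set
PairsInBounds {n} F l d =
  pairsIn F ≤ C₂ (1 + 2 * l + d) ⊎ pairsIn F ≤ C₂ (l + ⌈ d /2⌉) + (l + ⌈ d /2⌉) * (n ∸ (l + ⌈ d /2⌉))

pairsInBounds-even : ∀ {n} (F : Family n) → IsShifted F → ∀ l q → DCond F (suc l) (q + q) → PairsInBounds F l (q + q)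
pairsInBounds-even F shifted l q (inj₂ (d%2≡1 , _)) with () ← trans (sym (even%2≡0 q)) d%2≡1
pairsInBounds-even F shifted l q (inj₁ (_ , zero , () , _))
pairsInBounds-even {n} F shifted l q (inj₁ (_ , suc p , _ , i≤ , ij∉F)) =
  Sum.map (subst (λ z → pairsIn F ≤ C₂ z) j+k≡) (subst (λ L → pairsIn F ≤ C₂ L + L * (n ∸ L)) L≡)
    (missingPair-dichotomy F shifted p≤L (m≤m+n p (p + 0)) (trans (cong (λ z → pairIn F (suc p) (z ∸ suc p)) (sym sum≡)) ij∉F))
  where
  L = l + q
  p≤L : p ≤ L
  p≤L = subst (λ z → p ≤ l + z) (sym (n≡⌊n+n/2⌋ q)) (≤-pred i≤)
  sum≡ : 2 * suc l + (q + q) + 1 ≡ 3 + 2 * L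
  sum≡ = solve 2 (λ l q → con 2 :* (con 1 :+ l) :+ (q :+ q) :+ con 1 := con 3 :+ con 2 :* (l :+ q)) refl l q
  j+k≡ : 1 + 2 * L ∸ p + p ≡ 1 + 2 * l + (q + q)
  j+k≡ = trans (m∸n+n≡m (≤-trans p≤L (≤-trans (m≤n*m L 2) (n≤1+n _))))
               (solve 2 (λ l q → con 1 :+ con 2 :* (l :+ q) := con 1 :+ con 2 :* l :+ (q :+ q)) refl l q)
  L≡ : L ≡ l + ⌈ q + q /2⌉
  L≡ = cong (l +_) (n≡⌈n+n/2⌉ q)

pairsInBounds-odd : ∀ {n} (F : Family n) → IsShifted F → ∀ l q → DCond F (suc l) (suc (q + q)) → PairsInBounds F l (suc (q + q))
pairsInBounds-odd F shifted l q (inj₁ (d%2≡0 , _)) with () ← trans (sym d%2≡0) (odd%2≡1 q)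
pairsInBounds-odd {n} F shifted l q (inj₂ (_ , inj₁ 1j∉F)) =
  inj₁ (subst (pairsIn F ≤_) (trans (cong (C₂ j +_) (*-zeroʳ (n ∸ j))) (+-identityʳ (C₂ j)))
    (pairsIn-bound F shifted (s≤s z≤n) (trans (cong (pairIn F 1) (sym suc-j≡)) 1j∉F)))
  where
  j = 1 + 2 * l + suc (q + q)
  suc-j≡ : 2 * suc l + suc (q + q) ≡ suc j
  suc-j≡ = solve 2 (λ l q → con 2 :* (con 1 :+ l) :+ (con 1 :+ (q :+ q)) := con 1 :+ (con 1 :+ con 2 :* l :+ (con 1 :+ (q :+ q)))) refl l q
pairsInBounds-odd F shifted l q (inj₂ (_ , inj₂ (zero , () , _)))
pairsInBounds-odd F shifted l q (inj₂ (_ , inj₂ (suc zero , s≤s () , _)))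
pairsInBounds-odd F shifted l q (inj₂ (_ , inj₂ (suc (suc zero) , s≤s (s≤s ()) , _)))
pairsInBounds-odd {n} F shifted l q (inj₂ (_ , inj₂ (suc (suc (suc k)) , _ , i≤ , ij∉F))) =
  Sum.map (subst (λ z → pairsIn F ≤ C₂ z) j+k≡) (subst (λ L → pairsIn F ≤ C₂ L + L * (n ∸ L)) L≡)
    (missingPair-dichotomy F shifted p≤L p≤2k (trans (cong (λ z → pairIn F (suc p) (z ∸ suc p)) (sym sum≡)) ij∉F))
  where
  p = suc (suc k)
  L = l + suc q
  p≤L : p ≤ L
  p≤L = subst (λ z → p ≤ l + z) (trans (cong ⌊_/2⌋ (+-comm (suc (q + q)) 1)) (cong suc (sym (n≡⌊n+n/2⌋ q)))) (≤-pred i≤)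
  p≤2k : p ≤ 2 * suc k
  p≤2k = ≤-trans (s≤s (s≤s (m≤n+m k k))) (≤-reflexive (solve 1 (λ k → con 2 :+ (k :+ k) := con 2 :* (con 1 :+ k)) refl k))
  sum≡ : 2 * suc l + suc (q + q) + 2 ≡ 3 + 2 * L
  sum≡ = solve 2 (λ l q → con 2 :* (con 1 :+ l) :+ (con 1 :+ (q :+ q)) :+ con 2 := con 3 :+ con 2 :* (l :+ (con 1 :+ q))) refl l q
  j+k≡ : 1 + 2 * L ∸ p + suc k ≡ 1 + 2 * l + suc (q + q)
  j+k≡ = trans (m∸n+n≡m (≤-trans (n≤1+n (suc k)) (≤-trans p≤L (m≤n*m L 2))))
               (solve 2 (λ l q → con 2 :* (l :+ (con 1 :+ q)) := con 1 :+ con 2 :* l :+ (con 1 :+ (q :+ q))) refl l q)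
  L≡ : L ≡ l + ⌈ suc (q + q) /2⌉
  L≡ = cong (λ z → l + suc z) (n≡⌊n+n/2⌋ q)

DCond⇒pairsInBounds : ∀ {n} (F : Family n) → IsShifted F → ∀ l d → DCond F (suc l) d → PairsInBounds F l d
DCond⇒pairsInBounds F shifted l d cond with parity d
... | even q = pairsInBounds-even F shifted l q cond
... | odd q  = pairsInBounds-odd F shifted l q cond

n≡2ℓ+3c : ∀ n s ℓ c → n ≡ 2 * s + c → n + ℓ ≡ 3 * s → n ≡ 2 * ℓ + 3 * c
n≡2ℓ+3c n s ℓ c n≡2s+c n+ℓ≡3s = +-cancelˡ-≡ (2 * n) _ _ (begin
  2 * n + n                     ≡⟨ cong (λ m → 2 * m + m) n≡2s+c ⟩
  2 * (2 * s + c) + (2 * s + c)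
    ≡⟨ solve 2 (λ s c → con 2 :* (con 2 :* s :+ c) :+ (con 2 :* s :+ c) := con 2 :* (con 3 :* s) :+ con 3 :* c) refl s c ⟩
  2 * (3 * s) + 3 * c           ≡⟨ cong (λ m → 2 * m + 3 * c) n+ℓ≡3s ⟨
  2 * (n + ℓ) + 3 * c
    ≡⟨ solve 3 (λ n ℓ c → con 2 :* (n :+ ℓ) :+ con 3 :* c := con 2 :* n :+ (con 2 :* ℓ :+ con 3 :* c)) refl n ℓ c ⟩
  2 * n + (2 * ℓ + 3 * c)       ∎)
  where open ≡-Reasoning

-- Only the defining condition of d(F) is used, not its minimality.
corollary16 : (n s ℓ c : ℕ) → 1 ≤ n → 1 ≤ s →
    n ≡ 2 * s + c → n + ℓ ≡ 3 * s →
    1 ≤ c → c + 1 ≤ s → 1 ≤ ℓ → ℓ + 1 ≤ s →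
    (F : Family n) → IsShifted F → IsUpSet F → NoSingletons F →
    (d : ℕ) → IsDOf F ℓ d → d ≤ 2 * c →
    (2 * complP'Count n ℓ ≤ 2 * (y F 0 + y F 1 + y F 2) + (4 * ℓ + d ∸ 3) * d)
    ⊎ (2 * complPCount n ℓ ≤ 2 * (y F 0 + y F 1 + y F 2) + (2 * ℓ + 6 * c + 1 ∸ ⌈ d /2⌉) * ⌈ d /2⌉)
corollary16 n s (suc l) c 1≤n _ n≡2s+c n+ℓ≡3s _ _ _ _ F shifted upSet noSingletons d (cond , _) d≤2c =
  Sum.map (option₁ F l d M≤n 1≤n upSet noSingletons)
          (option₂ F l c ⌈ d /2⌉ n≡ h≤c 1≤n upSet noSingletons)
          (DCond⇒pairsInBounds F shifted l d cond)
  where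
  n≡ : n ≡ 2 * suc l + 3 * c
  n≡ = n≡2ℓ+3c n s (suc l) c n≡2s+c n+ℓ≡3s
  M≤n : 1 + 2 * l ≤ n
  M≤n = subst (1 + 2 * l ≤_)
    (sym (trans n≡ (solve 2 (λ l c → con 2 :* (con 1 :+ l) :+ con 3 :* c := (con 1 :+ con 2 :* l) :+ (con 1 :+ con 3 :* c)) refl l c)))
    (m≤m+n (1 + 2 * l) (1 + 3 * c))
  h≤c : ⌈ d /2⌉ ≤ c
  h≤c = ≤-trans (⌈n/2⌉-mono d≤2c) (≤-reflexive (trans (cong (λ m → ⌈ c + m /2⌉) (+-identityʳ c)) (sym (n≡⌈n+n/2⌉ c))))
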